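{- Let $L$ be a finite distributive lattice with bottom $\bot$ and top $\top$, let $c(L)$ be the set of its complemented elements, and for $x\in c(L)$ with complement $x'$ let $L(x):=\{(y,z)\in L\times L\mid y\leq x,\ z\leq x'\}$. Let $\widetilde{L}:=\{(y,z)\in L\times L\mid y\wedge z=\bot\}$. Then $\widetilde{L}=\bigcup_{x\in c(L)}L(x)$ if and only if every connected component of (the Hasse diagram of) the poset $\mathcal{J}(L)$ has a single bottom element (a least element).
   Context: $x\in L$ is complemented if there is $x'\in L$ with $x\wedge x'=\bot$ and $x\vee x'=\top$ (unique in a distributive lattice). $\mathcal{J}(L)$ is the set of join-irreducible elements of $L$ (elements covering exactly one element), ordered by the order of $L$. -}

module Defs where

open import Level using (_⊔_)
open import Data.Nat using (ℕ)
open import Data.Fin using (Fin)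
open import Data.Product using (Σ; ∃; ∃-syntax; _×_; _,_; proj₁)
open import Relation.Nullary using (¬_)
open import Relation.Binary.Lattice.Bundles using (DistributiveLattice)
open import Relation.Binary.Construct.Closure.Symmetric using (SymClosure)
open import Relation.Binary.Construct.Closure.ReflexiveTransitive using (Star)
open import Function.Bundles using (Inverse)
import Relation.Binary.PropositionalEquality as ≡

module LatticeNotions {c ℓ₁ ℓ₂} (L : DistributiveLattice c ℓ₁ ℓ₂) where
  open DistributiveLattice L

  Finite : Set (c ⊔ ℓ₁)
  Finite = ∃[ n ] Inverse setoid (≡.setoid (Fin n))

  _<_ : Carrier → Carrier → Set (ℓ₁ ⊔ ℓ₂)
  x < y = x ≤ y × ¬ (x ≈ y)

  _⋖_ : Carrier → Carrier → Set (c ⊔ ℓ₁ ⊔ ℓ₂)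
  x ⋖ y = x < y × (∀ z → ¬ (x < z × z < y))

  JoinIrreducible : Carrier → Set (c ⊔ ℓ₁ ⊔ ℓ₂)
  JoinIrreducible j = ∃[ x ] (x ⋖ j × (∀ x′ → x′ ⋖ j → x′ ≈ x))

  J : Set (c ⊔ ℓ₁ ⊔ ℓ₂)
  J = Σ Carrier JoinIrreducible

  _<J_ : J → J → Set (ℓ₁ ⊔ ℓ₂)
  a <J b = proj₁ a < proj₁ b

  _⋖J_ : J → J → Set (c ⊔ ℓ₁ ⊔ ℓ₂)
  a ⋖J b = a <J b × (∀ (k : J) → ¬ (a <J k × k <J b))

  Connected : J → J → Set (c ⊔ ℓ₁ ⊔ ℓ₂)
  Connected = Star (SymClosure _⋖J_)

  EveryComponentHasLeast : Set (c ⊔ ℓ₁ ⊔ ℓ₂)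
  EveryComponentHasLeast =
    ∀ (j : J) → ∃[ m ] (Connected j m × (∀ (k : J) → Connected j k → proj₁ m ≤ proj₁ k))

  module _ (⊤ ⊥ : Carrier) where
    IsComplement : Carrier → Carrier → Set ℓ₁
    IsComplement x x′ = (x ∧ x′ ≈ ⊥) × (x ∨ x′ ≈ ⊤)

    InLtilde : Carrier × Carrier → Set ℓ₁
    InLtilde (y , z) = y ∧ z ≈ ⊥

    InUnionLx : Carrier × Carrier → Set (c ⊔ ℓ₁ ⊔ ℓ₂)
    InUnionLx (y , z) = ∃[ x ] ∃[ x′ ] (IsComplement x x′ × y ≤ x × z ≤ x′)

    LtildeEqUnion : Set (c ⊔ ℓ₁ ⊔ ℓ₂)
    LtildeEqUnion = ∀ p → (InLtilde p → InUnionLx p) × (InUnionLx p → InLtilde p)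

module Submission where

open import Defs
open import Relation.Binary.Definitions using (Maximum; Minimum)
open import Relation.Binary.Lattice.Bundles using (DistributiveLattice)
open import Function.Bundles using (_⇔_)
open DistributiveLattice using (Carrier; _≤_)
open LatticeNotions using (Finite; LtildeEqUnion; EveryComponentHasLeast)

open import Level using (_⊔_)
open import Data.Bool.Base using (true)
open import Data.Empty using (⊥-elim)
open import Data.Fin.Base using (Fin)
import Data.Fin.Properties as Fin
open import Data.Fin.Subset using (Subset; _∈_; _⊂_)
open import Data.Fin.Subset.Induction using (⊂-wellFounded)
open import Data.Product using (∃; _×_; _,_; proj₁; proj₂)
open import Data.Sum using (_⊎_; inj₁; inj₂; [_,_]′)
open import Data.Vec.Base using (tabulate)
open import Data.Vec.Properties using (lookup∘tabulate; []=⇒lookup; lookup⇒[]=)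
open import Function.Base using (_∘_; flip)
open import Function.Bundles using (Inverse; Injection; mk⇔)
open import Function.Properties.Inverse using (Inverse⇒Injection)
open import Induction.WellFounded using (WellFounded; Acc; acc; module Subrelation)
import Relation.Binary.Construct.On as On
open import Relation.Binary.Construct.Closure.Symmetric using (fwd; bwd)
open import Relation.Binary.Construct.Closure.ReflexiveTransitive using (ε; _◅_)
open import Relation.Binary.Core using (Rel)
open import Relation.Binary.Definitions using (Decidable; _Respects_)
import Relation.Binary.Properties.Poset as PosetProperties
import Relation.Binary.Lattice.Properties.MeetSemilattice as MeetProperties
import Relation.Binary.Reasoning.PartialOrder as PosetReasoning
open import Relation.Nullary using (¬_; Dec; yes; no; does)
open import Relation.Nullary.Decidable using (_×-dec_; ¬?; map′; dec-true; decidable-stable)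
open import Relation.Unary using (Pred)
import Relation.Unary as Unary
import Relation.Binary.PropositionalEquality as ≡

-- Finiteness is used constructively: through the enumeration Fin n ↔ L,
-- equality and order are decidable, existence over L is decided by search,
-- and < is well-founded in both directions (it strictly changes principal
-- down- and up-sets, viewed as subsets of Fin n), so every satisfied
-- decidable property has minimal and maximal witnesses.
--
-- (⇐) If components have least elements, every j ∈ J(L) lies below a* or
--   a** for the pseudocomplement a* of any a, hence a** ∨ a* = ⊤ (L is a
--   Stone lattice); so y ∧ z = ⊥ gives (y , z) ∈ L(y**), with (y**)′ = y*.
-- (⇒) If L̃ = ⋃ L(x), an atom below j ∈ J(L) stays below everything reached
--   from j in the Hasse diagram: along a downward edge k′ ⋖ k, an atom below
--   k′ disjoint from it would be separated by a complemented pair x , x′, and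
--   join-primality of k in k ⊑ x ∨ x′ = ⊤ gives a contradiction.

fromDoes : ∀ {a} {A : Set a} (a? : Dec A) → does a? ≡.≡ true → A
fromDoes (yes a) _  = a
fromDoes (no _)  ()

subsetOf : ∀ {n p} {P : Pred (Fin n) p} → Unary.Decidable P → Subset n
subsetOf P? = tabulate (does ∘ P?)

module _ {n p} {P : Pred (Fin n) p} (P? : Unary.Decidable P) where

  ∈-subsetOf⁺ : ∀ {i} → P i → i ∈ subsetOf P?
  ∈-subsetOf⁺ {i} pi =
    lookup⇒[]= i (subsetOf P?) (≡.trans (lookup∘tabulate (does ∘ P?) i) (dec-true (P? i) pi))

  ∈-subsetOf⁻ : ∀ {i} → i ∈ subsetOf P? → P i
  ∈-subsetOf⁻ {i} i∈ =
    fromDoes (P? i) (≡.trans (≡.sym (lookup∘tabulate (does ∘ P?) i)) ([]=⇒lookup i∈))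

subsetOf-⊂ : ∀ {n p q} {P : Pred (Fin n) p} {Q : Pred (Fin n) q}
  (P? : Unary.Decidable P) (Q? : Unary.Decidable Q)
  → (∀ {i} → P i → Q i) → ∀ k → Q k → ¬ P k → subsetOf P? ⊂ subsetOf Q?
subsetOf-⊂ P? Q? P⇒Q k qk ¬pk =
  (λ i∈P → ∈-subsetOf⁺ Q? (P⇒Q (∈-subsetOf⁻ P? i∈P))) , k , ∈-subsetOf⁺ Q? qk , ¬pk ∘ ∈-subsetOf⁻ P?

minimalWitness : ∀ {a r q} {A : Set a} {_≺_ : Rel A r} → WellFounded _≺_ → {Q : Pred A q}
  → (∀ x → Dec (∃ λ u → u ≺ x × Q u))
  → ∀ {x} → Q x → ∃ λ m → Q m × (∀ {u} → u ≺ m → ¬ Q u)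
minimalWitness {_≺_ = _≺_} wf {Q} smaller? {x} = descend (wf x)
  where
  descend : ∀ {x} → Acc _≺_ x → Q x → ∃ λ m → Q m × (∀ {u} → u ≺ m → ¬ Q u)
  descend {x} (acc rec) qx with smaller? x
  ... | yes (u , u≺x , qu) = descend (rec u≺x) qu
  ... | no none            = x , qx , λ u≺x qu → none (_ , u≺x , qu)

module FiniteLattice {c ℓ₁ ℓ₂} (L : DistributiveLattice c ℓ₁ ℓ₂) (finite : Finite L) where
  open DistributiveLattice L renaming (Carrier to C; _≤_ to _⊑_)
  open LatticeNotions L using (_<_; _⋖_; JoinIrreducible; J; _<J_; _⋖J_; Connected)
  open PosetProperties poset using (<-trans; <-respˡ-≈; <-respʳ-≈; <⇒≱; ≰-respˡ-≈)
  open MeetProperties meetSemilattice using (≈-dec⇒≤-dec)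

  private
    n = proj₁ finite
    enum = proj₂ finite
  open Inverse enum using (to; from; to-cong; strictlyInverseʳ)
  open Injection (Inverse⇒Injection enum) using (injective)

  infix 4 _≈?_ _⊑?_ _<?_

  _≈?_ : Decidable _≈_
  x ≈? y = map′ injective to-cong (to x Fin.≟ to y)

  _⊑?_ : Decidable _⊑_
  _⊑?_ = ≈-dec⇒≤-dec _≈?_

  _<?_ : Decidable _<_
  x <? y = (x ⊑? y) ×-dec ¬? (x ≈? y)

  search : ∀ {q} {Q : Pred C q} → Q Respects _≈_ → Unary.Decidable Q → Dec (∃ Q)
  search resp Q? = map′ (λ (i , qi) → from i , qi)
                        (λ (x , qx) → to x , resp (Eq.sym (strictlyInverseʳ x)) qx)
                        (Fin.any? (Q? ∘ from))

  ∀? : ∀ {q r} {Q : Pred C q} {R : Pred C r} → Q Respects _≈_ → R Respects _≈_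
     → Unary.Decidable Q → Unary.Decidable R → Dec (∀ x → Q x → R x)
  ∀? respQ respR Q? R?
    with search (λ e (qx , ¬rx) → respQ e qx , ¬rx ∘ respR (Eq.sym e)) (λ x → Q? x ×-dec ¬? (R? x))
  ... | yes (x , qx , ¬rx) = no λ all → ¬rx (all x qx)
  ... | no none            = yes λ x qx → decidable-stable (R? x) λ ¬rx → none (x , qx , ¬rx)

  -- < strictly enlarges principal down-sets and shrinks principal up-sets,
  -- seen as subsets of the enumeration; hence < and > are well-founded.
  ↓_ ↑_ : C → Subset n
  ↓ x = subsetOf (λ i → from i ⊑? x)
  ↑ x = subsetOf (λ i → x ⊑? from i)

  ↓-strict : ∀ {x y} → x < y → ↓ x ⊂ ↓ y
  ↓-strict {x} {y} x<y@(x⊑y , _) =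
    subsetOf-⊂ (λ i → from i ⊑? x) (λ i → from i ⊑? y) (λ i⊑x → trans i⊑x x⊑y) (to y)
    (reflexive (strictlyInverseʳ y))
    (λ y⊑x → <⇒≱ x<y (trans (reflexive (Eq.sym (strictlyInverseʳ y))) y⊑x))

  ↑-strict : ∀ {x y} → x < y → ↑ y ⊂ ↑ x
  ↑-strict {x} {y} x<y@(x⊑y , _) =
    subsetOf-⊂ (λ i → y ⊑? from i) (λ i → x ⊑? from i) (trans x⊑y) (to x)
    (reflexive (Eq.sym (strictlyInverseʳ x)))
    (λ y⊑x → <⇒≱ x<y (trans y⊑x (reflexive (strictlyInverseʳ x))))

  <-wellFounded : WellFounded _<_
  <-wellFounded = Subrelation.wellFounded ↓-strict (On.wellFounded ↓_ ⊂-wellFounded)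

  >-wellFounded : WellFounded (flip _<_)
  >-wellFounded = Subrelation.wellFounded ↑-strict (On.wellFounded ↑_ ⊂-wellFounded)

  module _ {q} {Q : Pred C q} (resp : Q Respects _≈_) (Q? : Unary.Decidable Q) where

    minimal : ∀ {x} → Q x → ∃ λ m → Q m × (∀ {u} → u < m → ¬ Q u)
    minimal = minimalWitness <-wellFounded λ x →
      search (λ e (u<x , qu) → <-respˡ-≈ e u<x , resp e qu) (λ u → (u <? x) ×-dec Q? u)

    maximal : ∀ {x} → Q x → ∃ λ m → Q m × (∀ {u} → m < u → ¬ Q u)
    maximal = minimalWitness >-wellFounded λ x →
      search (λ e (x<u , qu) → <-respʳ-≈ e x<u , resp e qu) (λ u → (x <? u) ×-dec Q? u)

  ⋖-respˡ : ∀ {y} → (_⋖ y) Respects _≈_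
  ⋖-respˡ e (x<y , tight) = <-respˡ-≈ e x<y , λ z (x<z , z<y) → tight z (<-respˡ-≈ (Eq.sym e) x<z , z<y)

  ⋖-respʳ : ∀ {x} → (x ⋖_) Respects _≈_
  ⋖-respʳ e (x<y , tight) = <-respʳ-≈ e x<y , λ z (x<z , z<y) → tight z (x<z , <-respʳ-≈ (Eq.sym e) z<y)

  ⋖? : Decidable _⋖_
  ⋖? x y = (x <? y) ×-dec map′ (λ none z between → none (z , between)) (λ tight (z , between) → tight z between)
    (¬? (search (λ e (x<z , z<y) → <-respʳ-≈ e x<z , <-respˡ-≈ e z<y) (λ z → (x <? z) ×-dec (z <? y))))

  JoinIrreducible-resp : JoinIrreducible Respects _≈_
  JoinIrreducible-resp e (c , c⋖j , unique) = c , ⋖-respʳ e c⋖j , λ c′ c′⋖ → unique c′ (⋖-respʳ (Eq.sym e) c′⋖)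

  JoinIrreducible? : Unary.Decidable JoinIrreducible
  JoinIrreducible? j = search
    (λ e (c⋖j , unique) → ⋖-respˡ e c⋖j , λ c′ c′⋖j → Eq.trans (unique c′ c′⋖j) e)
    (λ c → ⋖? c j ×-dec ∀? ⋖-respˡ (λ e c′≈c → Eq.trans (Eq.sym e) c′≈c) (λ c′ → ⋖? c′ j) (_≈? c))

  ∧-< : ∀ {x y} → ¬ x ⊑ y → (x ∧ y) < x
  ∧-< {x} {y} x⋢y = x∧y≤x x y , λ e → x⋢y (trans (reflexive (Eq.sym e)) (x∧y≤y x y))

  -- An element minimal among those not below t is join-irreducible, with
  -- lower cover w ∧ t.
  minimalOutside⇒JoinIrreducible : ∀ {t w} → ¬ w ⊑ t → (∀ {u} → u < w → u ⊑ t) → JoinIrreducible w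
  minimalOutside⇒JoinIrreducible {t} {w} w⋢t below = w ∧ t , lowerCover , unique
    where
    w∧t<w : (w ∧ t) < w
    w∧t<w = ∧-< w⋢t

    lowerCover : (w ∧ t) ⋖ w
    lowerCover = w∧t<w , λ z (w∧t<z , z<w) → <⇒≱ w∧t<z (∧-greatest (proj₁ z<w) (below z<w))

    unique : ∀ c → c ⋖ w → c ≈ w ∧ t
    unique c (c<w , tight) = decidable-stable (c ≈? (w ∧ t)) λ c≉w∧t →
      tight (w ∧ t) ((∧-greatest (proj₁ c<w) (below c<w) , c≉w∧t) , w∧t<w)

  joinIrreducibleOutside : ∀ {t w} → ¬ w ⊑ t
    → ∃ λ (j : J) → proj₁ j ⊑ w × ¬ proj₁ j ⊑ t × (∀ {u} → u < proj₁ j → u ⊑ t)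
  joinIrreducibleOutside {t} {w} w⋢t
    with minimal {Q = λ u → u ⊑ w × ¬ u ⊑ t}
           (λ e (u⊑w , u⋢t) → ≤-respˡ-≈ e u⊑w , ≰-respˡ-≈ e u⋢t)
           (λ u → (u ⊑? w) ×-dec ¬? (u ⊑? t)) (refl , w⋢t)
  ... | m , (m⊑w , m⋢t) , noSmaller = (m , minimalOutside⇒JoinIrreducible m⋢t below) , m⊑w , m⋢t , below
    where
    below : ∀ {u} → u < m → u ⊑ t
    below {u} u<m = decidable-stable (u ⊑? t) λ u⋢t → noSmaller u<m (trans (proj₁ u<m) m⊑w , u⋢t)

  belowLowerCover : ∀ {j} (ji : JoinIrreducible j) → ∀ {u} → u < j → u ⊑ proj₁ ji
  belowLowerCover {j} (c , _ , unique) {u} u<j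
    with maximal {Q = λ v → u ⊑ v × v < j}
           (λ e (u⊑v , v<j) → ≤-respʳ-≈ e u⊑v , <-respˡ-≈ e v<j)
           (λ v → (u ⊑? v) ×-dec (v <? j)) (refl , u<j)
  ... | v , (u⊑v , v<j) , noLarger = trans u⊑v (reflexive (unique v v⋖j))
    where
    v⋖j : v ⋖ j
    v⋖j = v<j , λ z (v<z , z<j) → noLarger v<z (trans u⊑v (proj₁ v<z) , z<j)

  -- Join-irreducibles are join-prime (this is where distributivity enters).
  joinPrime : ∀ {j} → JoinIrreducible j → ∀ {p q} → j ⊑ p ∨ q → j ⊑ p ⊎ j ⊑ q
  joinPrime {j} ji@(c , (c<j , _) , _) {p} {q} j⊑p∨q with j ⊑? p | j ⊑? q
  ... | yes j⊑p | _       = inj₁ j⊑p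
  ... | no _    | yes j⊑q = inj₂ j⊑q
  ... | no j⋢p  | no j⋢q  = ⊥-elim (<⇒≱ c<j j⊑c)
    where
    j⊑c : j ⊑ c
    j⊑c = begin
      j                 ≤⟨ ∧-greatest refl j⊑p∨q ⟩
      j ∧ (p ∨ q)       ≈⟨ ∧-distribˡ-∨ j p q ⟩
      (j ∧ p) ∨ (j ∧ q) ≤⟨ ∨-least (belowLowerCover ji (∧-< j⋢p)) (belowLowerCover ji (∧-< j⋢q)) ⟩
      c                 ∎
      where open PosetReasoning poset

  BetweenJI : C → C → Pred C (c ⊔ ℓ₁ ⊔ ℓ₂)
  BetweenJI k j l = JoinIrreducible l × k < l × l < j

  BetweenJI-resp : ∀ {k j} → BetweenJI k j Respects _≈_
  BetweenJI-resp e (l-ji , k<l , l<j) = JoinIrreducible-resp e l-ji , <-respʳ-≈ e k<l , <-respˡ-≈ e l<j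

  BetweenJI? : ∀ k j → Unary.Decidable (BetweenJI k j)
  BetweenJI? k j l = JoinIrreducible? l ×-dec ((k <? l) ×-dec (l <? j))

  coverTowards : (j k : J) → k <J j → k ⋖J j ⊎ ∃ λ (l : J) → k <J l × l ⋖J j
  coverTowards (j , _) (k , _) k<j with search BetweenJI-resp (BetweenJI? k j)
  ... | no none = inj₁ (k<j , λ (l , l-ji) (k<l , l<j) → none (l , l-ji , k<l , l<j))
  ... | yes (_ , between) with maximal BetweenJI-resp (BetweenJI? k j) between
  ... | l , (l-ji , k<l , l<j) , noLarger =
    inj₂ ((l , l-ji) , k<l , l<j , λ (m , m-ji) (l<m , m<j) → noLarger l<m (m-ji , <-trans k<l l<m , m<j))

  connectedBelow : (j k : J) → k <J j → Connected j k
  connectedBelow j k = descend j (<-wellFounded (proj₁ j))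
    where
    descend : (j : J) → Acc _<_ (proj₁ j) → k <J j → Connected j k
    descend j (acc rec) k<j with coverTowards j k k<j
    ... | inj₁ k⋖j               = bwd k⋖j ◅ ε
    ... | inj₂ (l , k<l , l⋖j) = bwd l⋖j ◅ descend l (rec (proj₁ l⋖j)) k<l

module Theorem {c ℓ₁ ℓ₂} (L : DistributiveLattice c ℓ₁ ℓ₂) (⊤ ⊥ : Carrier L)
  (⊤-max : Maximum (_≤_ L) ⊤) (⊥-min : Minimum (_≤_ L) ⊥) (finite : Finite L) where
  open DistributiveLattice L renaming (Carrier to C; _≤_ to _⊑_)
  open LatticeNotions L using (_<_; J; _<J_; Connected; InLtilde; InUnionLx)
  open MeetProperties meetSemilattice using (∧-comm; ∧-cong; ∧-monotonic)
  open FiniteLattice L finite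

  Disjoint : C → C → Set ℓ₂
  Disjoint x y = x ∧ y ⊑ ⊥

  Disjoint-sym : ∀ {x y} → Disjoint x y → Disjoint y x
  Disjoint-sym {x} {y} = trans (reflexive (∧-comm y x))

  ⊑⊥⇒≈⊥ : ∀ {x} → x ⊑ ⊥ → x ≈ ⊥
  ⊑⊥⇒≈⊥ x⊑⊥ = antisym x⊑⊥ (⊥-min _)

  -- Everything strictly below m is ⊥; for m ≠ ⊥ this says m is an atom.
  OnlyBottomBelow : C → Set (c ⊔ ℓ₁ ⊔ ℓ₂)
  OnlyBottomBelow m = ∀ {u} → u < m → u ⊑ ⊥

  JoinIrreducible⋢⊥ : (j : J) → ¬ proj₁ j ⊑ ⊥
  JoinIrreducible⋢⊥ (j , c , ((c⊑j , c≉j) , _) , _) j⊑⊥ = c≉j (antisym c⊑j (trans j⊑⊥ (⊥-min c)))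

  -- A join-irreducible below j is reachable from j in the Hasse diagram of
  -- J(L), up to ≈ (the Hasse diagram only connects representatives).
  reachBelow : (j v : J) → proj₁ v ⊑ proj₁ j → ∃ λ v′ → Connected j v′ × proj₁ v′ ≈ proj₁ v
  reachBelow j v v⊑j with proj₁ v ≈? proj₁ j
  ... | yes v≈j = j , ε , Eq.sym v≈j
  ... | no v≉j  = v , connectedBelow j v (v⊑j , v≉j) , Eq.refl

  unionInLtilde : ∀ p → InUnionLx ⊤ ⊥ p → InLtilde ⊤ ⊥ p
  unionInLtilde (y , z) (x , x′ , (x∧x′≈⊥ , _) , y⊑x , z⊑x′) =
    ⊑⊥⇒≈⊥ (trans (∧-monotonic y⊑x z⊑x′) (reflexive x∧x′≈⊥))

  IsPseudocomplement : C → C → Set (c ⊔ ℓ₂)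
  IsPseudocomplement a s = Disjoint a s × (∀ {u} → Disjoint a u → u ⊑ s)

  -- Finite distributive lattices are pseudocomplemented: a maximal element
  -- disjoint from a is the largest one, as disjointness from a is closed under ∨.
  pseudocomplement : ∀ a → ∃ (IsPseudocomplement a)
  pseudocomplement a
    with maximal {Q = Disjoint a} (λ e → ≤-respˡ-≈ (∧-cong Eq.refl e)) (λ u → (a ∧ u) ⊑? ⊥) (x∧y≤y a ⊥)
  ... | s , a∧s⊑⊥ , noLarger = s , a∧s⊑⊥ , largest
    where
    largest : ∀ {u} → Disjoint a u → u ⊑ s
    largest {u} a∧u⊑⊥ = decidable-stable (u ⊑? s) λ u⋢s →
      noLarger (x≤x∨y s u , λ s≈s∨u → u⋢s (trans (y≤x∨y s u) (reflexive (Eq.sym s≈s∨u))))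
               (trans (reflexive (∧-distribˡ-∨ a s u)) (∨-least a∧s⊑⊥ a∧u⊑⊥))

  -- If m lies below everything in the component of j, then j is disjoint from
  -- every r with m ⋢ r: otherwise some join-irreducible below j ∧ r would lie above m.
  disjointUnlessAboveLeast : (j m : J) → (∀ k → Connected j k → proj₁ m ⊑ proj₁ k)
    → ∀ {r} → ¬ proj₁ m ⊑ r → Disjoint (proj₁ j) r
  disjointUnlessAboveLeast j m least {r} m⋢r = decidable-stable (proj₁ j ∧ r ⊑? ⊥) λ j∧r⋢⊥ →
    let (v , v⊑j∧r , _)      = joinIrreducibleOutside j∧r⋢⊥
        (v′ , j~v′ , v′≈v) = reachBelow j v (trans v⊑j∧r (x∧y≤x _ _))
    in m⋢r (trans (least v′ j~v′) (trans (reflexive v′≈v) (trans v⊑j∧r (x∧y≤y _ _))))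

  -- (⇐) If every component of J(L) has a least element, L is a Stone lattice.
  module _ (componentLeast : EveryComponentHasLeast L) where

    -- Every join-irreducible lies below a** or below a*, according to whether
    -- the least element of its component lies below a or not.
    belowPseudocomplements : ∀ {a s s′} → IsPseudocomplement a s → IsPseudocomplement s s′
      → (j : J) → proj₁ j ⊑ s′ ⊎ proj₁ j ⊑ s
    belowPseudocomplements {a} (a∧s⊑⊥ , s-largest) (_ , s′-largest) j with componentLeast j
    ... | m , _ , least with proj₁ m ⊑? a
    ... | yes m⊑a = inj₁ (s′-largest (Disjoint-sym (disjointUnlessAboveLeast j m least λ m⊑s →
                      JoinIrreducible⋢⊥ m (trans (∧-greatest m⊑a m⊑s) a∧s⊑⊥))))
    ... | no m⋢a  = inj₂ (s-largest (Disjoint-sym (disjointUnlessAboveLeast j m least m⋢a)))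

    -- Stone identity a** ∨ a* = ⊤: no join-irreducible escapes a** ∨ a*.
    stone : ∀ {a s s′} → IsPseudocomplement a s → IsPseudocomplement s s′ → s′ ∨ s ≈ ⊤
    stone {s = s} {s′} s-pc s′-pc = antisym (⊤-max _) (decidable-stable (⊤ ⊑? s′ ∨ s) λ ⊤⋢s′∨s →
      let (j , _ , j⋢s′∨s , _) = joinIrreducibleOutside ⊤⋢s′∨s
      in j⋢s′∨s ([ (λ j⊑s′ → trans j⊑s′ (x≤x∨y s′ s)) , (λ j⊑s → trans j⊑s (y≤x∨y s′ s)) ]′
                   (belowPseudocomplements s-pc s′-pc j)))

    -- A disjoint pair (y , z) lies in L(y**), with complement y*.
    componentsHaveLeast⇒LtildeEqUnion : LtildeEqUnion L ⊤ ⊥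
    componentsHaveLeast⇒LtildeEqUnion p@(y , z) = LtildeInUnion , unionInLtilde p
      where
      LtildeInUnion : InLtilde ⊤ ⊥ p → InUnionLx ⊤ ⊥ p
      LtildeInUnion y∧z≈⊥ =
        let (s , s-pc@(y∧s⊑⊥ , s-largest)) = pseudocomplement y
            (s′ , s′-pc@(s∧s′⊑⊥ , s′-largest)) = pseudocomplement s
        in s′ , s , (⊑⊥⇒≈⊥ (Disjoint-sym s∧s′⊑⊥) , stone s-pc s′-pc) ,
           s′-largest (Disjoint-sym y∧s⊑⊥) , s-largest (reflexive y∧z≈⊥)

  -- (⇒) If L̃ = ⋃ L(x), an atom below j is least in the component of j.
  module _ (Ltilde=Union : LtildeEqUnion L ⊤ ⊥) where

    -- Along a downward edge k′ < k of J(L), an atom m ⊑ k stays below k′: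
    -- otherwise an atom a ⊑ k′ is disjoint from m, so some complemented pair
    -- x , x′ has m ⊑ x and a ⊑ x′, and k ⊑ x ∨ x′ = ⊤ would force k ⊑ x or
    -- k ⊑ x′, making a resp. m disjoint from itself.
    atomDescends : (m : J) → OnlyBottomBelow (proj₁ m)
      → (k k′ : J) → k′ <J k → proj₁ m ⊑ proj₁ k → proj₁ m ⊑ proj₁ k′
    atomDescends (m , m-ji) atom (k , k-ji) (k′ , k′-ji) k′<k m⊑k = decidable-stable (m ⊑? k′) λ m⋢k′ →
      let (a , a⊑k′ , a⋢⊥ , _) = joinIrreducibleOutside (JoinIrreducible⋢⊥ (k′ , k′-ji))
          m∧a≈⊥ = ⊑⊥⇒≈⊥ (atom (∧-< (λ m⊑a → m⋢k′ (trans m⊑a a⊑k′))))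
          (x , x′ , (x∧x′≈⊥ , x∨x′≈⊤) , m⊑x , a⊑x′) = proj₁ (Ltilde=Union (m , proj₁ a)) m∧a≈⊥
          under : ∀ {w} → w ⊑ x → w ⊑ x′ → w ⊑ ⊥
          under w⊑x w⊑x′ = trans (∧-greatest w⊑x w⊑x′) (reflexive x∧x′≈⊥)
      in [ (λ k⊑x  → a⋢⊥ (under (trans a⊑k′ (trans (proj₁ k′<k) k⊑x)) a⊑x′))
         , (λ k⊑x′ → JoinIrreducible⋢⊥ (m , m-ji) (under m⊑x (trans m⊑k k⊑x′))) ]′
         (joinPrime k-ji (trans (⊤-max k) (reflexive (Eq.sym x∨x′≈⊤))))

    atomAlongPath : (m : J) → OnlyBottomBelow (proj₁ m)
      → ∀ {k l} → Connected k l → proj₁ m ⊑ proj₁ k → proj₁ m ⊑ proj₁ l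
    atomAlongPath m atom ε m⊑k = m⊑k
    atomAlongPath m atom (fwd (k<l , _) ◅ path) m⊑k =
      atomAlongPath m atom path (trans m⊑k (proj₁ k<l))
    atomAlongPath m atom {k} (_◅_ {j = l} (bwd (l<k , _)) path) m⊑k =
      atomAlongPath m atom path (atomDescends m atom k l l<k m⊑k)

    LtildeEqUnion⇒componentsHaveLeast : EveryComponentHasLeast L
    LtildeEqUnion⇒componentsHaveLeast j =
      let (m , m⊑j , _ , atom) = joinIrreducibleOutside (JoinIrreducible⋢⊥ j)
          (m′ , j~m′ , m′≈m) = reachBelow j m m⊑j
      in m′ , j~m′ , λ k j~k → trans (reflexive m′≈m) (atomAlongPath m atom j~k m⊑j)

mainTheorem4 : ∀ {c ℓ₁ ℓ₂} (L : DistributiveLattice c ℓ₁ ℓ₂)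
    → (⊤ ⊥ : Carrier L) → Maximum (_≤_ L) ⊤ → Minimum (_≤_ L) ⊥ → Finite L
    → LtildeEqUnion L ⊤ ⊥ ⇔ EveryComponentHasLeast L
mainTheorem4 L ⊤ ⊥ ⊤-max ⊥-min finite =
  mk⇔ LtildeEqUnion⇒componentsHaveLeast componentsHaveLeast⇒LtildeEqUnion
  where open Theorem L ⊤ ⊥ ⊤-max ⊥-min finite
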